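{- The rewriting relation $\to$ on well-typed let-terms preserves the denotational interpretation: if $\ell\to\ell'$ then $[\![\ell]\!]=[\![\ell']\!]$.
   Context: Types: positive $P,Q::=\mathsf{Bool}\mid P\otimes Q$; arrow $N::=P\multimap T$; let-term types $T,U::=P\mid N\mid P\otimes T$. Each variable carries a fixed type $\mathsf{ty}(v)$, positive or arrow; $x,y,z$ positive variables, $f,g,h$ arrow variables. Webs: $|\mathsf{Bool}|=\{\mathsf t,\mathsf f\}$, $|P\otimes T|=|P\multimap T|=|P|\times|T|$. Constants $M$ are stochastic matrices in $\mathbb R_{\ge0}^{|P|\times|Q|}$ of type $P\multimap Q$ (or $0$-ary probability vectors of type $Q$). Syntax: patterns $\vec v::=v\mid(\vec v,\vec v')$ (components with disjoint variables); expressions $e::=v\mid M(\vec x)\mid f\,\vec x\mid (e,e')\mid \lambda\vec x.e\mid \mathtt{let}\ \vec v=e\ \mathtt{in}\ e'$ ($\vec x$ a positive pattern); let-terms $\ell::=\vec v\mid \mathtt{let}\ \vec v=e\ \mathtt{in}\ \ell$. Binders and $FV$, $FV^a$ as usual. Typing: $v:\mathsf{ty}(v)$; $f:P\multimap T,\vec x:P\Rightarrow f\vec x:T$; $M:P\multimap Q,\vec x:P\Rightarrow M(\vec x):Q$; $\vec x:P,e:T\Rightarrow\lambda\vec x.e:P\multimap T$; $e:P,e':T$, $FV^a(e)\cap FV^a(e')=\emptyset\Rightarrow(e,e'):P\otimes T$; $\vec v:T,e:T,e':U$, $FV^a(e)\cap FV^a(e')=\emptyset$, each arrow variable of $\vec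 v$ in $FV^a(e')$ $\Rightarrow\mathtt{let}\ \vec v=e\ \mathtt{in}\ e':U$. $\vec v^a$ is the (at most one) arrow variable of a pattern, $\vec v^+$ the pattern with it removed. $(\vec v_1=e_1;\vec v_2=e_2\ \mathtt{in}\ \ell)$ abbreviates nested lets. Bound variables are pairwise distinct and distinct from free ones. Semantics: $|V|=\prod_{v\in V}|\mathsf{ty}(v)|$ (functions $a$; restriction $a|_{V'}$; union $a\uplus b$); elements of $|FV(\vec v)|$ identified with elements of $|\mathsf{ty}(\vec v)|$. $[\![e]\!]\in\mathbb R_{\ge0}^{|FV(e)|\times|\mathsf{ty}(e)|}$: $[\![v]\!]_{a,b}=\delta_{a_v,b}$; $[\![(e',e'')]\!]_{a,(b',b'')}=[\![e']\!]_{a|_{FV(e')},b'}[\![e'']\!]_{a|_{FV(e'')},b''}$; $[\![\mathtt{let}\ \vec v=e'\ \mathtt{in}\ e'']\!]_{a,b}=\sum_{c\in|FV(\vec v)|}[\![e']\!]_{a|_{FV(e')},c}[\![e'']\!]_{(a\uplus c)|_{FV(e'')},b}$; $[\![\lambda\vec v.e']\!]_{a,(b',b'')}=[\![e']\!]_{(a\uplus b')|_{FV(e')},b''}$; $[\![M(\vec x)]\!]_{a,b}=M_{a,b}$; $[\![f\vec x]\!]_{a,b}=\delta_{a',a'''}\delta_{a'',b}$ where $a_f=(a',a'')$, $a|_{\vec x}=a'''$. Rewriting rules ($\ell$ a let-term): ($S_1$) $(\vec v_1=e_1;\vec v_2=e_2\ \mathtt{in}\ \ell)\to(\vec v_2=e_2;\vec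 v_1=e_1\ \mathtt{in}\ \ell)$ if $FV(\vec v_1)\cap FV(e_2)=\emptyset$; ($S_2$) $\to(f=\lambda\vec x.e_2;\vec v_1=e_1;\vec v_2=f\vec x\ \mathtt{in}\ \ell)$ ($f$ fresh) if $\vec x=FV(\vec v_1)\cap FV(e_2)$ is positive and non-empty; ($S_3$) $\to((\vec v_1^+,\vec v_2)=(\mathtt{let}\ \vec v_1=e_1\ \mathtt{in}\ (\vec v_1^+,e_2))\ \mathtt{in}\ \ell)$ if $\vec v_1^a=f$ with $f\in FV(e_2)$; ($M$) $\to((\vec v_1,\vec v_2)=(\mathtt{let}\ \vec v_1=e_1\ \mathtt{in}\ (\vec v_1,e_2))\ \mathtt{in}\ \ell)$ if $\vec v_1$ positive; ($E_x$) $(\mathtt{let}\ \vec v=e_1\ \mathtt{in}\ \ell)\to(\mathtt{let}\ \vec v'=(\mathtt{let}\ \vec v=e_1\ \mathtt{in}\ \vec v')\ \mathtt{in}\ \ell)$ if $x\notin FV(\ell)$ and $\vec v'$ is non-empty and obtained from $\vec v$ by removing $x$. If $\vec v^+$ is empty, $(\vec v^+,e)$ stands for $e$. $\to$ applies one rule to the let-term or to any of its tails after some definitions. -}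

module Defs where

open import Level using (_⊔_)
open import Data.Bool using (Bool; true; false; if_then_else_)
open import Data.Nat using (ℕ)
import Data.Nat.Properties as ℕP
open import Data.Product using (_×_; _,_; proj₁; proj₂)
open import Data.Product.Properties using (≡-dec)
open import Data.Sum using (_⊎_)
import Data.Sum
open import Data.Maybe using (Maybe; just; nothing)
open import Data.List using (List; []; _∷_; _++_; [_]; filter; filterᵇ; foldr; cartesianProductWith)
open import Data.List.Membership.Propositional using (_∈_; _∉_)
open import Data.List.Relation.Unary.All using (All)
open import Data.List.Relation.Unary.Unique.Propositional using (Unique)
open import Data.List.Relation.Binary.Disjoint.Propositional using (Disjoint)
open import Relation.Nullary using (Dec; yes; no; ¬?)
open import Relation.Nullary.Decidable using (⌊_⌋)
open import Relation.Binary.PropositionalEquality using (_≡_; refl; cong; cong₂)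
open import Relation.Binary.Definitions using (DecidableEquality)
open import Algebra.Bundles using (CommutativeSemiring)

infixr 6 _⊗_
infixr 5 _⊸_

data Ty : Set where
  bool : Ty
  _⊗_  : Ty → Ty → Ty
  _⊸_  : Ty → Ty → Ty

data IsPos : Ty → Set where
  pbool : IsPos bool
  ptens : ∀ {P Q} → IsPos P → IsPos Q → IsPos (P ⊗ Q)

mutual
  data IsArr : Ty → Set where
    arr : ∀ {P T} → IsPos P → IsLetTy T → IsArr (P ⊸ T)

  data IsLetTy : Ty → Set where
    lpos  : ∀ {P} → IsPos P → IsLetTy P
    larr  : ∀ {N} → IsArr N → IsLetTy N
    ltens : ∀ {P T} → IsPos P → IsLetTy T → IsLetTy (P ⊗ T)

isArrow : Ty → Bool
isArrow (_ ⊸ _) = true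
isArrow _       = false

_≟Ty_ : DecidableEquality Ty
bool    ≟Ty bool    = yes refl
bool    ≟Ty (_ ⊗ _) = no (λ ())
bool    ≟Ty (_ ⊸ _) = no (λ ())
(_ ⊗ _) ≟Ty bool    = no (λ ())
(A ⊗ B) ≟Ty (C ⊗ D) with A ≟Ty C | B ≟Ty D
... | yes refl | yes refl = yes refl
... | no ne    | _        = no (λ { refl → ne refl })
... | yes _    | no ne    = no (λ { refl → ne refl })
(_ ⊗ _) ≟Ty (_ ⊸ _) = no (λ ())
(_ ⊸ _) ≟Ty bool    = no (λ ())
(_ ⊸ _) ≟Ty (_ ⊗ _) = no (λ ())
(A ⊸ B) ≟Ty (C ⊸ D) with A ≟Ty C | B ≟Ty D
... | yes refl | yes refl = yes refl
... | no ne    | _        = no (λ { refl → ne refl })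
... | yes _    | no ne    = no (λ { refl → ne refl })

Var : Set
Var = ℕ × Ty

ty : Var → Ty
ty = proj₂

_≟V_ : DecidableEquality Var
_≟V_ = ≡-dec ℕP._≟_ _≟Ty_

open import Data.List.Membership.DecPropositional _≟V_ using (_∈?_)

_∖_ : List Var → List Var → List Var
xs ∖ ys = filter (λ v → ¬? (v ∈? ys)) xs

-- Webs: elements of |T| are represented in a universal tree type W,
-- |bool| = {t,f}, |P ⊗ T| = |P ⊸ T| = |P| × |T|.

data W : Set where
  wt wf : W
  _,,_  : W → W → W

_≟W_ : DecidableEquality W
wt ≟W wt = yes refl
wt ≟W wf = no (λ ())
wt ≟W (_ ,, _) = no (λ ())
wf ≟W wt = no (λ ())
wf ≟W wf = yes refl
wf ≟W (_ ,, _) = no (λ ())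
(_ ,, _) ≟W wt = no (λ ())
(_ ,, _) ≟W wf = no (λ ())
(a ,, b) ≟W (c ,, d) with a ≟W c | b ≟W d
... | yes refl | yes refl = yes refl
... | no ne    | _        = no (λ { refl → ne refl })
... | yes _    | no ne    = no (λ { refl → ne refl })

web : Ty → List W
web bool    = wt ∷ wf ∷ []
web (A ⊗ B) = cartesianProductWith _,,_ (web A) (web B)
web (A ⊸ B) = cartesianProductWith _,,_ (web A) (web B)

-- valuations of all variables; an element a ∈ |V| is the restriction to V
Env : Set
Env = Var → W

WfEnv : Env → Set
WfEnv ρ = ∀ v → ρ v ∈ web (ty v)

_[_↦_] : Env → Var → W → Env
(ρ [ x ↦ c ]) v with v ≟V x
... | yes _ = c
... | no  _ = ρ v

data Pat : Set where
  pv : Var → Pat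
  pp : Pat → Pat → Pat

pvars : Pat → List Var
pvars (pv v)   = [ v ]
pvars (pp p q) = pvars p ++ pvars q

patTy : Pat → Ty
patTy (pv v)   = ty v
patTy (pp p q) = patTy p ⊗ patTy q

-- removing a variable from a pattern (nothing = the empty pattern)
removeVar : Var → Pat → Maybe Pat
removeVar x (pv v) = if ⌊ v ≟V x ⌋ then nothing else just (pv v)
removeVar x (pp p q) with removeVar x p | removeVar x q
... | nothing | r       = r
... | just p' | nothing = just p'
... | just p' | just q' = just (pp p' q')

-- (v⁺ , v₂) with the convention that an empty v⁺ is dropped
pairPat : Maybe Pat → Pat → Pat
pairPat nothing  q = q
pairPat (just p) q = pp p q

lookP : Pat → Env → W
lookP (pv v)   ρ = ρ v
lookP (pp p q) ρ = lookP p ρ ,, lookP q ρ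

-- a ⊎ c : extend a valuation by c ∈ |FV(v)| ≅ |ty(v)|
match : Pat → W → Env → Env
match (pv v)   c          ρ = ρ [ v ↦ c ]
match (pp p q) (c₁ ,, c₂) ρ = match q c₂ (match p c₁ ρ)
match (pp p q) _          ρ = ρ

module Lang {c ℓ} (R : CommutativeSemiring c ℓ) where
  open CommutativeSemiring R public using (Carrier; _≈_; _+_; _*_; 0#; 1#)

  δ : W → W → Carrier
  δ a b = if ⌊ a ≟W b ⌋ then 1# else 0#

  sumL : List W → (W → Carrier) → Carrier
  sumL xs f = foldr (λ w acc → f w + acc) 0# xs

  record Matrix : Set (c ⊔ ℓ) where
    field
      dom cod : Ty
      domPos  : IsPos dom
      codPos  : IsPos cod
      mat     : W → W → Carrier
      stoch   : ∀ a → a ∈ web dom → sumL (web cod) (mat a) ≈ 1#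

  record Vector : Set (c ⊔ ℓ) where
    field
      cod    : Ty
      codPos : IsPos cod
      vec    : W → Carrier
      stoch  : sumL (web cod) vec ≈ 1#

  data Expr : Set (c ⊔ ℓ) where
    var  : Var → Expr
    cst  : Matrix → Pat → Expr
    cst₀ : Vector → Expr
    app  : Var → Pat → Expr
    pair : Expr → Expr → Expr
    lam  : Pat → Expr → Expr
    let′ : Pat → Expr → Expr → Expr

  ⌜_⌝ : Pat → Expr
  ⌜ pv v ⌝   = var v
  ⌜ pp p q ⌝ = pair ⌜ p ⌝ ⌜ q ⌝

  FV : Expr → List Var
  FV (var v)       = [ v ]
  FV (cst M p)     = pvars p
  FV (cst₀ V)      = []
  FV (app f p)     = f ∷ pvars p
  FV (pair e e')   = FV e ++ FV e'
  FV (lam p e)     = FV e ∖ pvars p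
  FV (let′ p e e') = FV e ++ (FV e' ∖ pvars p)

  FVa : Expr → List Var
  FVa e = filterᵇ (λ v → isArrow (ty v)) (FV e)

  -- binding occurrences (with multiplicity)
  BV : Expr → List Var
  BV (var v)       = []
  BV (cst M p)     = []
  BV (cst₀ V)      = []
  BV (app f p)     = []
  BV (pair e e')   = BV e ++ BV e'
  BV (lam p e)     = pvars p ++ BV e
  BV (let′ p e e') = pvars p ++ BV e ++ BV e'

  allVars : Expr → List Var
  allVars e = FV e ++ BV e

  Barendregt : Expr → Set
  Barendregt e = Unique (BV e) × Disjoint (BV e) (FV e)

  tyOf : Expr → Ty
  tyOf (var v)       = ty v
  tyOf (cst M p)     = Matrix.cod M
  tyOf (cst₀ V)      = Vector.cod V
  tyOf (app f p) with ty f
  ... | _ ⊸ T = T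
  ... | _     = bool
  tyOf (pair e e')   = tyOf e ⊗ tyOf e'
  tyOf (lam p e)     = patTy p ⊸ tyOf e
  tyOf (let′ p e e') = tyOf e'

  infix 4 _⦂_
  data _⦂_ : Expr → Ty → Set (c ⊔ ℓ) where
    tvar  : ∀ v → (IsPos (ty v) Data.Sum.⊎ IsArr (ty v)) → var v ⦂ ty v
    tapp  : ∀ {f x P T} → ty f ≡ (P ⊸ T) → IsArr (ty f) → IsPos P → ⌜ x ⌝ ⦂ P → app f x ⦂ T
    tcst  : ∀ {M x} → ⌜ x ⌝ ⦂ Matrix.dom M → cst M x ⦂ Matrix.cod M
    tcst₀ : ∀ {V} → cst₀ V ⦂ Vector.cod V
    tlam  : ∀ {x e P T} → IsPos P → Unique (pvars x) → ⌜ x ⌝ ⦂ P → e ⦂ T → lam x e ⦂ (P ⊸ T)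
    tpair : ∀ {e e' P T} → IsPos P → e ⦂ P → e' ⦂ T → Disjoint (FVa e) (FVa e')
          → pair e e' ⦂ (P ⊗ T)
    tlet  : ∀ {v e e' T U} → Unique (pvars v) → ⌜ v ⌝ ⦂ T → e ⦂ T → e' ⦂ U
          → Disjoint (FVa e) (FVa e')
          → All (λ g → isArrow (ty g) ≡ true → g ∈ FV e') (pvars v)
          → let′ v e e' ⦂ U

  ⟦_⟧ : Expr → Env → W → Carrier
  ⟦ var v ⟧ ρ b = δ (ρ v) b
  ⟦ cst M x ⟧ ρ b = Matrix.mat M (lookP x ρ) b
  ⟦ cst₀ V ⟧ ρ b = Vector.vec V b
  ⟦ app f x ⟧ ρ b with ρ f
  ... | a′ ,, a″ = δ a′ (lookP x ρ) * δ a″ b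
  ... | _        = 0#
  ⟦ pair e e' ⟧ ρ (b′ ,, b″) = ⟦ e ⟧ ρ b′ * ⟦ e' ⟧ ρ b″
  ⟦ pair e e' ⟧ ρ _ = 0#
  ⟦ lam x e ⟧ ρ (b′ ,, b″) = ⟦ e ⟧ (match x b′ ρ) b″
  ⟦ lam x e ⟧ ρ _ = 0#
  ⟦ let′ v e e' ⟧ ρ b = sumL (web (patTy v)) (λ c′ → ⟦ e ⟧ ρ c′ * ⟦ e' ⟧ (match v c′ ρ) b)

  data IsPatE : Expr → Set (c ⊔ ℓ) where
    pvar  : ∀ v → IsPatE (var v)
    ppair : ∀ {e e'} → IsPatE e → IsPatE e' → IsPatE (pair e e')

  data IsLT : Expr → Set (c ⊔ ℓ) where
    ltpat : ∀ {e} → IsPatE e → IsLT e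
    ltlet : ∀ {v e l} → IsLT l → IsLT (let′ v e l)

  -- (e , e') with the convention that an empty v⁺ is dropped
  pairE : Maybe Pat → Expr → Expr
  pairE nothing  e = e
  pairE (just p) e = pair ⌜ p ⌝ e

  infix 4 _⟶_
  data _⟶_ : Expr → Expr → Set (c ⊔ ℓ) where
    S₁ : ∀ {v₁ e₁ v₂ e₂ l} → IsLT l → Disjoint (pvars v₁) (FV e₂)
       → let′ v₁ e₁ (let′ v₂ e₂ l) ⟶ let′ v₂ e₂ (let′ v₁ e₁ l)
    S₂ : ∀ {v₁ e₁ v₂ e₂ l} (x : Pat) (f : Var) → IsLT l
       → (∀ v → (v ∈ pvars x → v ∈ pvars v₁ × v ∈ FV e₂)
              × (v ∈ pvars v₁ × v ∈ FV e₂ → v ∈ pvars x))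
       → Unique (pvars x)
       → All (λ v → IsPos (ty v)) (pvars x)
       → ty f ≡ (patTy x ⊸ tyOf e₂)
       → f ∉ allVars (let′ v₁ e₁ (let′ v₂ e₂ l))
       → let′ v₁ e₁ (let′ v₂ e₂ l)
         ⟶ let′ (pv f) (lam x e₂) (let′ v₁ e₁ (let′ v₂ (app f x) l))
    S₃ : ∀ {v₁ e₁ v₂ e₂ l} (f : Var) → IsLT l
       → f ∈ pvars v₁ → isArrow (ty f) ≡ true → f ∈ FV e₂
       → let′ v₁ e₁ (let′ v₂ e₂ l)
         ⟶ let′ (pairPat (removeVar f v₁) v₂)
                 (let′ v₁ e₁ (pairE (removeVar f v₁) e₂)) l
    Mr : ∀ {v₁ e₁ v₂ e₂ l} → IsLT l → IsPos (patTy v₁)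
       → let′ v₁ e₁ (let′ v₂ e₂ l)
         ⟶ let′ (pp v₁ v₂) (let′ v₁ e₁ (pair ⌜ v₁ ⌝ e₂)) l
    Eₓ : ∀ {v e₁ l} (x : Var) (v' : Pat) → IsLT l
       → IsPos (ty x) → x ∈ pvars v → x ∉ FV l → removeVar x v ≡ just v'
       → let′ v e₁ l ⟶ let′ v' (let′ v e₁ ⌜ v' ⌝) l
    tail : ∀ {v e l l'} → l ⟶ l' → let′ v e l ⟶ let′ v e l'

{-# OPTIONS --safe #-}

-- A let sums over the web of its pattern, ⟦let v = e in e′⟧ a b = Σ_c ⟦e⟧ a c · ⟦e′⟧ (a ⊎ c) b, so
-- every rule is an identity between nested finite sums, valid in any commutative semiring. The identities follow from exchanging and regrouping sums and from
-- the sifting property Σ_c δ a c · f c = f a over the duplicate-free web, which absorbs the sums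
-- introduced by pattern expressions and, in S₂, the sum over the graph of the new function f.
-- The side conditions (freshness, Barendregt's convention, linearity of arrow variables) enter only
-- through the fact that ⟦e⟧ reads the valuation on FV(e) alone.

module Submission where

open import Defs
open import Algebra.Bundles using (CommutativeSemiring)
import Algebra.Properties.CommutativeSemigroup as CommutativeSemigroupProperties
open import Data.Bool using (true)
open import Data.Bool.Properties using (T-≡)
open import Data.Empty using (⊥-elim)
open import Data.Maybe using (Maybe; just; nothing)
open import Data.Product using (_×_; _,_; proj₁; proj₂)
open import Data.Sum using (_⊎_; inj₁; inj₂)
open import Data.List using (List; []; _∷_; _++_; map; cartesianProductWith)
open import Data.List.Properties using (++-identityʳ)
open import Data.List.Membership.Propositional using (_∈_; _∉_)
open import Data.List.Membership.Propositional.Properties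
  using (∈-++⁺ˡ; ∈-++⁺ʳ; ∈-++⁻; ∈-filter⁺; ∈-filter⁻; ∈-cartesianProductWith⁺; ∈-cartesianProductWith⁻)
open import Data.List.Membership.DecPropositional _≟V_ using (_∈?_)
open import Data.List.Relation.Binary.Disjoint.Propositional using (Disjoint)
open import Data.List.Relation.Binary.Subset.Propositional using (_⊆_)
open import Data.List.Relation.Unary.Any using (here; there)
open import Data.List.Relation.Unary.Any.Properties using (¬Any[])
open import Data.List.Relation.Unary.All using (All; []; _∷_)
import Data.List.Relation.Unary.All as All
open import Data.List.Relation.Unary.AllPairs using ([]; _∷_)
open import Data.List.Relation.Unary.Unique.Propositional using (Unique)
open import Data.List.Relation.Unary.Unique.Propositional.Properties using (cartesianProductWith⁺)
open import Function using (Equivalence)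
open import Relation.Nullary using (yes; no; ¬?)
open import Relation.Nullary.Decidable using (T?)
open import Relation.Binary.PropositionalEquality using (_≡_; _≢_; refl; sym; trans; cong; cong₂; subst)
import Relation.Binary.Reasoning.Setoid as SetoidReasoning

∈-∖⁺ : ∀ {w : Var} {xs ys} → w ∈ xs → w ∉ ys → w ∈ xs ∖ ys
∈-∖⁺ {ys = ys} = ∈-filter⁺ (λ v → ¬? (v ∈? ys))

∈-∖⁻ : ∀ {w : Var} {xs ys} → w ∈ xs ∖ ys → w ∈ xs × w ∉ ys
∈-∖⁻ {ys = ys} = ∈-filter⁻ (λ v → ¬? (v ∈? ys))

Unique-++⇒Disjoint : ∀ {a} {A : Set a} (xs : List A) {ys} → Unique (xs ++ ys) → Disjoint xs ys
Unique-++⇒Disjoint (x ∷ xs) (x∉ ∷ _) (here refl , w∈ys) = All.lookup x∉ (∈-++⁺ʳ xs w∈ys) refl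
Unique-++⇒Disjoint (x ∷ xs) (_ ∷ u) (there w∈xs , w∈ys) = Unique-++⇒Disjoint xs u (w∈xs , w∈ys)

Unique-++⁻ʳ : ∀ {a} {A : Set a} (xs : List A) {ys} → Unique (xs ++ ys) → Unique ys
Unique-++⁻ʳ []       u       = u
Unique-++⁻ʳ (_ ∷ xs) (_ ∷ u) = Unique-++⁻ʳ xs u

web-unique : ∀ T → Unique (web T)
web-unique bool    = ((λ ()) ∷ []) ∷ [] ∷ []
web-unique (A ⊗ B) = cartesianProductWith⁺ _,,_ (λ { refl → refl , refl }) (web-unique A) (web-unique B)
web-unique (A ⊸ B) = cartesianProductWith⁺ _,,_ (λ { refl → refl , refl }) (web-unique A) (web-unique B)

Agree : List Var → Env → Env → Set
Agree xs ρ ρ′ = ∀ {w} → w ∈ xs → ρ w ≡ ρ′ w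

[↦]-same : ∀ ρ x c → (ρ [ x ↦ c ]) x ≡ c
[↦]-same ρ x c with x ≟V x
... | yes _   = refl
... | no x≢x = ⊥-elim (x≢x refl)

[↦]-other : ∀ ρ {x} c {w} → w ≢ x → (ρ [ x ↦ c ]) w ≡ ρ w
[↦]-other ρ {x} c {w} w≢x with w ≟V x
... | yes w≡x = ⊥-elim (w≢x w≡x)
... | no _    = refl

[↦]-∉ : ∀ ρ {x} c {xs} → x ∉ xs → Agree xs (ρ [ x ↦ c ]) ρ
[↦]-∉ ρ c x∉ w∈ = [↦]-other ρ c (λ { refl → x∉ w∈ })

match-∉ : ∀ p c ρ {w} → w ∉ pvars p → match p c ρ w ≡ ρ w
match-∉ (pv v)   c          ρ w∉ = [↦]-other ρ c (λ w≡v → w∉ (here w≡v))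
match-∉ (pp p q) (c₁ ,, c₂) ρ w∉ =
  trans (match-∉ q c₂ _ (λ m → w∉ (∈-++⁺ʳ (pvars p) m))) (match-∉ p c₁ ρ (λ m → w∉ (∈-++⁺ˡ m)))
match-∉ (pp p q) wt         ρ w∉ = refl
match-∉ (pp p q) wf         ρ w∉ = refl

match-pointwise : ∀ p c {ρ ρ′ w} → ρ w ≡ ρ′ w → match p c ρ w ≡ match p c ρ′ w
match-pointwise (pv v)   c {w = w} eq with w ≟V v
... | yes _ = refl
... | no _  = eq
match-pointwise (pp p q) (c₁ ,, c₂) eq = match-pointwise q c₂ (match-pointwise p c₁ eq)
match-pointwise (pp p q) wt         eq = eq
match-pointwise (pp p q) wf         eq = eq

-- match leaves the valuation unchanged on ill-shaped values (match (pp p q) wt ρ = ρ),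
-- hence the web hypothesis here and in everything built on it.
match-∈ : ∀ p {c} ρ ρ′ {w} → c ∈ web (patTy p) → w ∈ pvars p → match p c ρ w ≡ match p c ρ′ w
match-∈ (pv v) {c} ρ ρ′ _ (here refl) = trans ([↦]-same ρ v c) (sym ([↦]-same ρ′ v c))
match-∈ (pp p q) ρ ρ′ {w} c∈ w∈
  with ∈-cartesianProductWith⁻ _,,_ (web (patTy p)) (web (patTy q)) c∈ | ∈-++⁻ (pvars p) w∈
... | c₁ , c₂ , c₁∈ , _ , refl | inj₁ w∈p = match-pointwise q c₂ (match-∈ p ρ ρ′ c₁∈ w∈p)
... | c₁ , _ , _ , c₂∈ , refl | inj₂ w∈q = match-∈ q (match p c₁ ρ) (match p c₁ ρ′) c₂∈ w∈q

match-cong : ∀ p {c ρ ρ′} xs → c ∈ web (patTy p) → Agree (xs ∖ pvars p) ρ ρ′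
           → Agree xs (match p c ρ) (match p c ρ′)
match-cong p {c} {ρ} {ρ′} xs c∈ agree {w} w∈ with w ∈? pvars p
... | yes w∈p = match-∈ p ρ ρ′ c∈ w∈p
... | no w∉p  = match-pointwise p c (agree (∈-∖⁺ w∈ w∉p))

match-comm : ∀ p q {c d} ρ → Disjoint (pvars p) (pvars q) → c ∈ web (patTy p)
           → ∀ w → match p c (match q d ρ) w ≡ match q d (match p c ρ) w
match-comm p q {c} {d} ρ p#q c∈ w with w ∈? pvars p
... | yes w∈p = trans (match-∈ p _ ρ c∈ w∈p) (sym (match-∉ q d _ (λ w∈q → p#q (w∈p , w∈q))))
... | no w∉p  = trans (match-∉ p c _ w∉p) (match-pointwise q d (sym (match-∉ p c ρ w∉p)))

match-disjoint : ∀ p c ρ {xs} → Disjoint (pvars p) xs → Agree xs (match p c ρ) ρ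
match-disjoint p c ρ p#xs w∈ = match-∉ p c ρ (λ w∈p → p#xs (w∈p , w∈))

match-lookP : ∀ p σ ρ → Agree (pvars p) (match p (lookP p σ) ρ) σ
match-lookP (pv v)   σ ρ (here refl) = [↦]-same ρ v (σ v)
match-lookP (pp p q) σ ρ {w} w∈ with w ∈? pvars q | ∈-++⁻ (pvars p) w∈
... | yes w∈q | _        = match-lookP q σ _ w∈q
... | no w∉q  | inj₁ w∈p = trans (match-∉ q _ _ w∉q) (match-lookP p σ ρ w∈p)
... | no w∉q  | inj₂ w∈q = ⊥-elim (w∉q w∈q)

rematch-agree : ∀ v p c ρ xs → (∀ {w} → w ∈ xs → w ∈ pvars v → w ∈ pvars p)
              → Agree xs (match p (lookP p (match v c ρ)) ρ) (match v c ρ)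
rematch-agree v p c ρ xs kept {w} w∈ with w ∈? pvars p | w ∈? pvars v
... | yes w∈p | _        = match-lookP p (match v c ρ) ρ w∈p
... | no w∉p  | yes w∈v  = ⊥-elim (w∉p (kept w∈ w∈v))
... | no w∉p  | no w∉v   = trans (match-∉ p _ ρ w∉p) (sym (match-∉ v c ρ w∉v))

lookP-cong : ∀ p {ρ ρ′} → Agree (pvars p) ρ ρ′ → lookP p ρ ≡ lookP p ρ′
lookP-cong (pv v)   agree = agree (here refl)
lookP-cong (pp p q) agree =
  cong₂ _,,_ (lookP-cong p (λ m → agree (∈-++⁺ˡ m))) (lookP-cong q (λ m → agree (∈-++⁺ʳ (pvars p) m)))

match-wf : ∀ p {c ρ} → WfEnv ρ → c ∈ web (patTy p) → WfEnv (match p c ρ)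
match-wf (pv v) {c} ρ-wf c∈ w with w ≟V v
... | yes w≡v = subst (λ u → c ∈ web (ty u)) (sym w≡v) c∈
... | no _    = ρ-wf w
match-wf (pp p q) ρ-wf c∈ with ∈-cartesianProductWith⁻ _,,_ (web (patTy p)) (web (patTy q)) c∈
... | _ , _ , c₁∈ , c₂∈ , refl = match-wf q (match-wf p ρ-wf c₁∈) c₂∈

lookP-wf : ∀ p {ρ} → WfEnv ρ → lookP p ρ ∈ web (patTy p)
lookP-wf (pv v)   ρ-wf = ρ-wf v
lookP-wf (pp p q) ρ-wf = ∈-cartesianProductWith⁺ _,,_ (lookP-wf p ρ-wf) (lookP-wf q ρ-wf)

pvarsᵐ : Maybe Pat → List Var
pvarsᵐ nothing  = []
pvarsᵐ (just p) = pvars p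

pvarsᵐ-removeVar-pp : ∀ x p q
                    → pvarsᵐ (removeVar x (pp p q)) ≡ pvarsᵐ (removeVar x p) ++ pvarsᵐ (removeVar x q)
pvarsᵐ-removeVar-pp x p q with removeVar x p | removeVar x q
... | nothing | _       = refl
... | just p′ | nothing = sym (++-identityʳ (pvars p′))
... | just _  | just _  = refl

removeVar-⊆ : ∀ x p → pvars p ⊆ x ∷ pvarsᵐ (removeVar x p)
removeVar-⊆ x (pv v) (here refl) with v ≟V x
... | yes v≡x = here v≡x
... | no _    = there (here refl)
removeVar-⊆ x (pp p q) w∈ rewrite pvarsᵐ-removeVar-pp x p q with ∈-++⁻ (pvars p) w∈
... | inj₁ w∈p with removeVar-⊆ x p w∈p
...   | here w≡x = here w≡x
...   | there w∈ = there (∈-++⁺ˡ w∈)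
removeVar-⊆ x (pp p q) w∈ | inj₂ w∈q with removeVar-⊆ x q w∈q
...   | here w≡x = here w≡x
...   | there w∈ = there (∈-++⁺ʳ (pvarsᵐ (removeVar x p)) w∈)

removeVar-kept : ∀ x p {xs} → x ∉ xs → ∀ {w} → w ∈ xs → w ∈ pvars p → w ∈ pvarsᵐ (removeVar x p)
removeVar-kept x p x∉ w∈ w∈p with removeVar-⊆ x p w∈p
... | here refl = ⊥-elim (x∉ w∈)
... | there w∈  = w∈

module Soundness {c ℓ} (R : CommutativeSemiring c ℓ) where
  open Lang R
  open CommutativeSemiring R
    using ( setoid; +-cong; *-cong; *-congˡ; *-congʳ; *-assoc
          ; +-assoc; +-identityˡ; +-identityʳ; *-identityˡ; zeroˡ; zeroʳ; distribˡ; distribʳ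
          ; +-commutativeSemigroup; *-commutativeSemigroup )
    renaming (refl to ≈-refl; sym to ≈-sym; trans to ≈-trans; reflexive to ≈-reflexive)
  open CommutativeSemigroupProperties +-commutativeSemigroup using (interchange)
  open CommutativeSemigroupProperties *-commutativeSemigroup using (x∙yz≈y∙xz)
  open SetoidReasoning setoid

  sumL-cong : ∀ xs {f g : W → Carrier} → (∀ {w} → w ∈ xs → f w ≈ g w) → sumL xs f ≈ sumL xs g
  sumL-cong []       f≈g = ≈-refl
  sumL-cong (x ∷ xs) f≈g = +-cong (f≈g (here refl)) (sumL-cong xs (λ m → f≈g (there m)))

  sumL-zero : ∀ xs → sumL xs (λ _ → 0#) ≈ 0#
  sumL-zero []       = ≈-refl
  sumL-zero (x ∷ xs) = ≈-trans (+-identityˡ _) (sumL-zero xs)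

  sumL-+ : ∀ xs f g → sumL xs (λ w → f w + g w) ≈ sumL xs f + sumL xs g
  sumL-+ []       f g = ≈-sym (+-identityˡ 0#)
  sumL-+ (x ∷ xs) f g = ≈-trans (+-cong ≈-refl (sumL-+ xs f g)) (interchange _ _ _ _)

  *-distribˡ-sumL : ∀ xs a f → a * sumL xs f ≈ sumL xs (λ w → a * f w)
  *-distribˡ-sumL []       a f = zeroʳ a
  *-distribˡ-sumL (x ∷ xs) a f = ≈-trans (distribˡ _ _ _) (+-cong ≈-refl (*-distribˡ-sumL xs a f))

  *-distribʳ-sumL : ∀ xs a f → sumL xs f * a ≈ sumL xs (λ w → f w * a)
  *-distribʳ-sumL []       a f = zeroˡ a
  *-distribʳ-sumL (x ∷ xs) a f = ≈-trans (distribʳ _ _ _) (+-cong ≈-refl (*-distribʳ-sumL xs a f))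

  sumL-comm : ∀ xs ys (f : W → W → Carrier)
            → sumL xs (λ x → sumL ys (f x)) ≈ sumL ys (λ y → sumL xs (λ x → f x y))
  sumL-comm []       ys f = ≈-sym (sumL-zero ys)
  sumL-comm (x ∷ xs) ys f =
    ≈-trans (+-cong ≈-refl (sumL-comm xs ys f)) (≈-sym (sumL-+ ys (f x) (λ y → sumL xs (λ x′ → f x′ y))))

  sumL-++ : ∀ xs ys f → sumL (xs ++ ys) f ≈ sumL xs f + sumL ys f
  sumL-++ []       ys f = ≈-sym (+-identityˡ _)
  sumL-++ (x ∷ xs) ys f = ≈-trans (+-cong ≈-refl (sumL-++ xs ys f)) (≈-sym (+-assoc _ _ _))

  sumL-map : ∀ (h : W → W) ys f → sumL (map h ys) f ≡ sumL ys (λ y → f (h y))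
  sumL-map h []       f = refl
  sumL-map h (y ∷ ys) f = cong (f (h y) +_) (sumL-map h ys f)

  sumL-cartesianProduct : ∀ xs ys f
    → sumL (cartesianProductWith _,,_ xs ys) f ≈ sumL xs (λ x → sumL ys (λ y → f (x ,, y)))
  sumL-cartesianProduct []       ys f = ≈-refl
  sumL-cartesianProduct (x ∷ xs) ys f =
    ≈-trans (sumL-++ (map (x ,,_) ys) _ f)
            (+-cong (≈-reflexive (sumL-map (x ,,_) ys f)) (sumL-cartesianProduct xs ys f))

  sumL-*-sumL : ∀ xs ys (f : W → Carrier) (g : W → W → Carrier)
              → sumL xs (λ x → f x * sumL ys (g x)) ≈ sumL xs (λ x → sumL ys (λ y → f x * g x y))
  sumL-*-sumL xs ys f g = sumL-cong xs (λ {x} _ → *-distribˡ-sumL ys (f x) (g x))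

  sumL-*-sumL-comm : ∀ xs ys (f g : W → Carrier) (h : W → W → Carrier)
                   → sumL xs (λ x → f x * sumL ys (λ y → g y * h x y))
                   ≈ sumL ys (λ y → g y * sumL xs (λ x → f x * h x y))
  sumL-*-sumL-comm xs ys f g h = begin
    sumL xs (λ x → f x * sumL ys (λ y → g y * h x y))
      ≈⟨ sumL-*-sumL xs ys f _ ⟩
    sumL xs (λ x → sumL ys (λ y → f x * (g y * h x y)))
      ≈⟨ sumL-comm xs ys _ ⟩
    sumL ys (λ y → sumL xs (λ x → f x * (g y * h x y)))
      ≈⟨ sumL-cong ys (λ _ → sumL-cong xs (λ _ → x∙yz≈y∙xz _ _ _)) ⟩
    sumL ys (λ y → sumL xs (λ x → g y * (f x * h x y)))
      ≈⟨ sumL-*-sumL ys xs g _ ⟨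
    sumL ys (λ y → g y * sumL xs (λ x → f x * h x y))
      ∎

  sumL-assoc : ∀ xs ys (f : W → Carrier) (g : W → W → Carrier) (h : W → Carrier)
             → sumL ys (λ y → sumL xs (λ x → f x * g x y) * h y)
             ≈ sumL xs (λ x → f x * sumL ys (λ y → g x y * h y))
  sumL-assoc xs ys f g h = begin
    sumL ys (λ y → sumL xs (λ x → f x * g x y) * h y)
      ≈⟨ sumL-cong ys (λ {y} _ → *-distribʳ-sumL xs (h y) _) ⟩
    sumL ys (λ y → sumL xs (λ x → (f x * g x y) * h y))
      ≈⟨ sumL-comm ys xs _ ⟩
    sumL xs (λ x → sumL ys (λ y → (f x * g x y) * h y))
      ≈⟨ sumL-cong xs (λ _ → sumL-cong ys (λ _ → *-assoc _ _ _)) ⟩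
    sumL xs (λ x → sumL ys (λ y → f x * (g x y * h y)))
      ≈⟨ sumL-*-sumL xs ys f _ ⟨
    sumL xs (λ x → f x * sumL ys (λ y → g x y * h y))
      ∎

  sumL-sumL-*-sumL-comm : ∀ xs ys zs (g : W → W → Carrier) (f : W → Carrier) (h k : W → W → Carrier)
    → sumL xs (λ a → sumL ys (λ d → g a d * sumL zs (λ c → f c * (h c a * k c d))))
    ≈ sumL zs (λ c → f c * sumL xs (λ a → h c a * sumL ys (λ d → g a d * k c d)))
  sumL-sumL-*-sumL-comm xs ys zs g f h k = begin
    sumL xs (λ a → sumL ys (λ d → g a d * sumL zs (λ c → f c * (h c a * k c d))))
      ≈⟨ sumL-cong xs (λ {a} _ → sumL-*-sumL-comm ys zs (g a) f _) ⟩
    sumL xs (λ a → sumL zs (λ c → f c * sumL ys (λ d → g a d * (h c a * k c d))))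
      ≈⟨ sumL-comm xs zs _ ⟩
    sumL zs (λ c → sumL xs (λ a → f c * sumL ys (λ d → g a d * (h c a * k c d))))
      ≈⟨ sumL-cong zs (λ {c} _ → *-distribˡ-sumL xs (f c) _) ⟨
    sumL zs (λ c → f c * sumL xs (λ a → sumL ys (λ d → g a d * (h c a * k c d))))
      ≈⟨ sumL-cong zs (λ {c} _ → *-congˡ (sumL-cong xs (λ {a} _ → ≈-trans
           (sumL-cong ys (λ _ → x∙yz≈y∙xz _ _ _)) (≈-sym (*-distribˡ-sumL ys (h c a) _))))) ⟩
    sumL zs (λ c → f c * sumL xs (λ a → h c a * sumL ys (λ d → g a d * k c d)))
      ∎

  δ-refl : ∀ a → δ a a ≡ 1#
  δ-refl a with a ≟W a
  ... | yes _   = refl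
  ... | no a≢a = ⊥-elim (a≢a refl)

  δ-≢ : ∀ {a b} → a ≢ b → δ a b ≡ 0#
  δ-≢ {a} {b} a≢b with a ≟W b
  ... | yes a≡b = ⊥-elim (a≢b a≡b)
  ... | no _    = refl

  δ-sym : ∀ a b → δ a b ≡ δ b a
  δ-sym a b with a ≟W b | b ≟W a
  ... | yes _   | yes _   = refl
  ... | no _    | no _    = refl
  ... | yes a≡b | no b≢a = ⊥-elim (b≢a (sym a≡b))
  ... | no a≢b  | yes b≡a = ⊥-elim (a≢b (sym b≡a))

  δ-,, : ∀ a₁ a₂ c₁ c₂ → δ (a₁ ,, a₂) (c₁ ,, c₂) ≈ δ a₁ c₁ * δ a₂ c₂
  δ-,, a₁ a₂ c₁ c₂ with a₁ ≟W c₁ | a₂ ≟W c₂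
  ... | yes refl | yes refl = ≈-sym (*-identityˡ 1#)
  ... | no _     | _        = ≈-sym (zeroˡ _)
  ... | yes refl | no _     = ≈-sym (zeroʳ _)

  δ-≢-* : ∀ {a b} y → a ≢ b → δ a b * y ≈ 0#
  δ-≢-* y a≢b = ≈-trans (*-congʳ (≈-reflexive (δ-≢ a≢b))) (zeroˡ y)

  sumL-δ-∉ : ∀ {a} xs (f : W → Carrier) → All (a ≢_) xs → sumL xs (λ c → δ a c * f c) ≈ 0#
  sumL-δ-∉ []       f []              = ≈-refl
  sumL-δ-∉ (x ∷ xs) f (a≢x ∷ a∉xs) =
    ≈-trans (+-cong (δ-≢-* (f x) a≢x) (sumL-δ-∉ xs f a∉xs)) (+-identityˡ 0#)

  sumL-δ : ∀ {a} xs (f : W → Carrier) → Unique xs → a ∈ xs → sumL xs (λ c → δ a c * f c) ≈ f a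
  sumL-δ (x ∷ xs) f (x∉xs ∷ _) (here refl) = begin
    δ x x * f x + sumL xs (λ c → δ x c * f c)
      ≈⟨ +-cong (*-congʳ (≈-reflexive (δ-refl x))) (sumL-δ-∉ xs f x∉xs) ⟩
    1# * f x + 0#   ≈⟨ +-identityʳ _ ⟩
    1# * f x        ≈⟨ *-identityˡ (f x) ⟩
    f x             ∎
  sumL-δ {a} (x ∷ xs) f (x∉xs ∷ u) (there a∈xs) =
    ≈-trans (+-cong (δ-≢-* (f x) a≢x) (sumL-δ xs f u a∈xs)) (+-identityˡ (f a))
    where
      a≢x : a ≢ x
      a≢x a≡x = All.lookup x∉xs (subst (_∈ xs) a≡x a∈xs) refl

  sumL-δ-web : ∀ T {a} (f : W → Carrier) → a ∈ web T → sumL (web T) (λ c → δ a c * f c) ≈ f a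
  sumL-δ-web T f = sumL-δ (web T) f (web-unique T)

  patTy-⦂ : ∀ {p T} → ⌜ p ⌝ ⦂ T → patTy p ≡ T
  patTy-⦂ {pv v}   (tvar v _)          = refl
  patTy-⦂ {pp p q} (tpair _ ⊢p ⊢q _) = cong₂ _⊗_ (patTy-⦂ ⊢p) (patTy-⦂ ⊢q)

  tyOf-⦂ : ∀ {e T} → e ⦂ T → tyOf e ≡ T
  tyOf-⦂ (tvar v _)               = refl
  tyOf-⦂ (tapp ty-f _ _ _)        rewrite ty-f = refl
  tyOf-⦂ (tcst _)                 = refl
  tyOf-⦂ tcst₀                    = refl
  tyOf-⦂ (tlam _ _ ⊢x ⊢e)         = cong₂ _⊸_ (patTy-⦂ ⊢x) (tyOf-⦂ ⊢e)
  tyOf-⦂ (tpair _ ⊢e ⊢e′ _)       = cong₂ _⊗_ (tyOf-⦂ ⊢e) (tyOf-⦂ ⊢e′)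
  tyOf-⦂ (tlet _ _ _ ⊢e′ _ _)     = tyOf-⦂ ⊢e′

  retype : ∀ {p e T} → ⌜ p ⌝ ⦂ T → e ⦂ T → e ⦂ patTy p
  retype ⊢p ⊢e = subst (_ ⦂_) (sym (patTy-⦂ ⊢p)) ⊢e

  ∈-web-≡ : ∀ {A B c} → A ≡ B → c ∈ web A → c ∈ web B
  ∈-web-≡ refl c∈ = c∈

  ∈-FVa⁺ : ∀ e {w} → w ∈ FV e → isArrow (ty w) ≡ true → w ∈ FVa e
  ∈-FVa⁺ _ w∈ arrow = ∈-filter⁺ (λ v → T? (isArrow (ty v))) w∈ (Equivalence.from T-≡ arrow)

  FV-let-body : ∀ v e l {w} → w ∈ FV l → w ∈ pvars v ⊎ w ∈ FV (let′ v e l)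
  FV-let-body v e l {w} w∈ with w ∈? pvars v
  ... | yes w∈v = inj₁ w∈v
  ... | no w∉v  = inj₂ (∈-++⁺ʳ (FV e) (∈-∖⁺ {xs = FV l} w∈ w∉v))

  Barendregt-let⁻ : ∀ v e l → Barendregt (let′ v e l) → Barendregt l
  Barendregt-let⁻ v e l (unique , bound#free) =
    Unique-++⁻ʳ (BV e) (Unique-++⁻ʳ (pvars v) unique) , bound#free′
    where
      bound#free′ : Disjoint (BV l) (FV l)
      bound#free′ (w∈BV , w∈FV) with FV-let-body v e l w∈FV
      ... | inj₁ w∈v   = Unique-++⇒Disjoint (pvars v) unique (w∈v , ∈-++⁺ʳ (BV e) w∈BV)
      ... | inj₂ w∈let = bound#free (∈-++⁺ʳ (pvars v) (∈-++⁺ʳ (BV e) w∈BV) , w∈let)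

  ⟦pattern⟧ : ∀ p σ b → ⟦ ⌜ p ⌝ ⟧ σ b ≈ δ (lookP p σ) b
  ⟦pattern⟧ (pv v)   σ b          = ≈-refl
  ⟦pattern⟧ (pp p q) σ (b₁ ,, b₂) =
    ≈-trans (*-cong (⟦pattern⟧ p σ b₁) (⟦pattern⟧ q σ b₂)) (≈-sym (δ-,, _ _ _ _))
  ⟦pattern⟧ (pp p q) σ wt         = ≈-refl
  ⟦pattern⟧ (pp p q) σ wf         = ≈-refl

  sumL-⟦pattern⟧ : ∀ p {σ} (f : W → Carrier) → WfEnv σ
                 → sumL (web (patTy p)) (λ c → ⟦ ⌜ p ⌝ ⟧ σ c * f c) ≈ f (lookP p σ)
  sumL-⟦pattern⟧ p {σ} f σ-wf =
    ≈-trans (sumL-cong (web (patTy p)) (λ {c} _ → *-congʳ (⟦pattern⟧ p σ c)))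
            (sumL-δ-web (patTy p) f (lookP-wf p σ-wf))

  app-cong : ∀ f x {ρ ρ′} b → ρ f ≡ ρ′ f → lookP x ρ ≡ lookP x ρ′ → ⟦ app f x ⟧ ρ b ≡ ⟦ app f x ⟧ ρ′ b
  app-cong f x {ρ} {ρ′} b ρf≡ρ′f x≡ with ρ f | ρ′ f | ρf≡ρ′f
  ... | a′ ,, a″ | _ | refl = cong (λ a → δ a′ a * δ a″ b) x≡
  ... | wt       | _ | refl = refl
  ... | wf       | _ | refl = refl

  app-value : ∀ f x {σ a d} b → σ f ≡ (a ,, d) → ⟦ app f x ⟧ σ b ≡ δ a (lookP x σ) * δ d b
  app-value f x {σ} b σf≡ with σ f | σf≡
  ... | _ | refl = refl

  ⟦⟧-agree : ∀ {e T ρ ρ′ b} → e ⦂ T → Agree (FV e) ρ ρ′ → b ∈ web T → ⟦ e ⟧ ρ b ≈ ⟦ e ⟧ ρ′ b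
  ⟦⟧-agree {b = b} (tvar v _) agree _ = ≈-reflexive (cong (λ a → δ a b) (agree (here refl)))
  ⟦⟧-agree {b = b} (tapp {f} {x} _ _ _ _) agree _ =
    ≈-reflexive (app-cong f x b (agree (here refl)) (lookP-cong x (λ m → agree (there m))))
  ⟦⟧-agree {b = b} (tcst {M} {x} _) agree _ =
    ≈-reflexive (cong (λ a → Matrix.mat M a b) (lookP-cong x agree))
  ⟦⟧-agree tcst₀ _ _ = ≈-refl
  ⟦⟧-agree (tlam {x} {e} {P} {T} _ _ ⊢x ⊢e) agree b∈
    with ∈-cartesianProductWith⁻ _,,_ (web P) (web T) b∈
  ... | _ , _ , b₁∈ , b₂∈ , refl =
    ⟦⟧-agree ⊢e (match-cong x (FV e) (∈-web-≡ (sym (patTy-⦂ ⊢x)) b₁∈) agree) b₂∈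
  ⟦⟧-agree (tpair {e} {e′} {P} {T} _ ⊢e ⊢e′ _) agree b∈
    with ∈-cartesianProductWith⁻ _,,_ (web P) (web T) b∈
  ... | _ , _ , b₁∈ , b₂∈ , refl =
    *-cong (⟦⟧-agree ⊢e (λ m → agree (∈-++⁺ˡ m)) b₁∈) (⟦⟧-agree ⊢e′ (λ m → agree (∈-++⁺ʳ (FV e) m)) b₂∈)
  ⟦⟧-agree (tlet {v} {e} {e′} _ ⊢v ⊢e ⊢e′ _ _) agree b∈ =
    sumL-cong (web (patTy v)) λ c∈ →
      *-cong (⟦⟧-agree ⊢e (λ m → agree (∈-++⁺ˡ m)) (∈-web-≡ (patTy-⦂ ⊢v) c∈))
             (⟦⟧-agree ⊢e′ (match-cong v (FV e′) c∈ (λ m → agree (∈-++⁺ʳ (FV e) m))) b∈)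

  ⟦let-let⟧ : ∀ p v e₁ e l ρ b
            → ⟦ let′ p (let′ v e₁ e) l ⟧ ρ b
            ≈ sumL (web (patTy v)) (λ c → ⟦ e₁ ⟧ ρ c *
                sumL (web (patTy p)) (λ c′ → ⟦ e ⟧ (match v c ρ) c′ * ⟦ l ⟧ (match p c′ ρ) b))
  ⟦let-let⟧ p v e₁ e l ρ b = sumL-assoc (web (patTy v)) (web (patTy p)) _ _ _

  ⟦let-app⟧ : ∀ v f x l {σ a d} b → σ f ≡ (a ,, d) → d ∈ web (patTy v)
            → ⟦ let′ v (app f x) l ⟧ σ b ≈ δ a (lookP x σ) * ⟦ l ⟧ (match v d σ) b
  ⟦let-app⟧ v f x l {σ} {a} {d} b σf≡ d∈ = begin
    sumL Wv (λ c → ⟦ app f x ⟧ σ c * L c)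
      ≈⟨ sumL-cong Wv (λ {c} _ → *-congʳ (≈-reflexive (app-value f x c σf≡))) ⟩
    sumL Wv (λ c → (δ a X * δ d c) * L c)   ≈⟨ sumL-cong Wv (λ _ → *-assoc _ _ _) ⟩
    sumL Wv (λ c → δ a X * (δ d c * L c))   ≈⟨ *-distribˡ-sumL Wv _ _ ⟨
    δ a X * sumL Wv (λ c → δ d c * L c)     ≈⟨ *-congˡ (sumL-δ-web (patTy v) L d∈) ⟩
    δ a X * L d                             ∎
    where
      Wv = web (patTy v)
      X = lookP x σ
      L : W → Carrier
      L c = ⟦ l ⟧ (match v c σ) b

  sumL-⟦pattern,⟧ : ∀ p e Q {σ} (F : W → Carrier) → WfEnv σ
    → sumL (web (patTy p ⊗ Q)) (λ cc → ⟦ pair ⌜ p ⌝ e ⟧ σ cc * F cc)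
    ≈ sumL (web Q) (λ c → ⟦ e ⟧ σ c * F (lookP p σ ,, c))
  sumL-⟦pattern,⟧ p e Q {σ} F σ-wf = begin
    sumL (web (patTy p ⊗ Q)) (λ cc → ⟦ pair ⌜ p ⌝ e ⟧ σ cc * F cc)
      ≈⟨ sumL-cartesianProduct Wp (web Q) _ ⟩
    sumL Wp (λ a → sumL (web Q) (λ c → (⟦ ⌜ p ⌝ ⟧ σ a * ⟦ e ⟧ σ c) * F (a ,, c)))
      ≈⟨ sumL-cong Wp (λ _ → sumL-cong (web Q) (λ _ → *-assoc _ _ _)) ⟩
    sumL Wp (λ a → sumL (web Q) (λ c → ⟦ ⌜ p ⌝ ⟧ σ a * (⟦ e ⟧ σ c * F (a ,, c))))
      ≈⟨ sumL-*-sumL Wp (web Q) _ _ ⟨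
    sumL Wp (λ a → ⟦ ⌜ p ⌝ ⟧ σ a * sumL (web Q) (λ c → ⟦ e ⟧ σ c * F (a ,, c)))
      ≈⟨ sumL-⟦pattern⟧ p _ σ-wf ⟩
    sumL (web Q) (λ c → ⟦ e ⟧ σ c * F (lookP p σ ,, c))
      ∎
    where Wp = web (patTy p)

  S₁-sound : ∀ v₁ e₁ v₂ e₂ l {U} → e₁ ⦂ patTy v₁ → e₂ ⦂ patTy v₂ → l ⦂ U
           → Disjoint (pvars v₁) (FV e₂) → Disjoint (pvars v₂) (FV e₁) → Disjoint (pvars v₁) (pvars v₂)
           → ∀ ρ b → b ∈ web U
           → ⟦ let′ v₁ e₁ (let′ v₂ e₂ l) ⟧ ρ b ≈ ⟦ let′ v₂ e₂ (let′ v₁ e₁ l) ⟧ ρ b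
  S₁-sound v₁ e₁ v₂ e₂ l ⊢e₁ ⊢e₂ ⊢l v₁#e₂ v₂#e₁ v₁#v₂ ρ b b∈ = begin
    ⟦ let′ v₁ e₁ (let′ v₂ e₂ l) ⟧ ρ b
      ≈⟨ sumL-cong W₁ (λ c₁∈ → *-congˡ (sumL-cong W₂ (λ c₂∈ →
           *-cong (⟦⟧-agree ⊢e₂ (match-disjoint v₁ _ ρ v₁#e₂) c₂∈)
                  (⟦⟧-agree ⊢l (λ {w} _ → sym (match-comm v₁ v₂ ρ v₁#v₂ c₁∈ w)) b∈)))) ⟩
    sumL W₁ (λ c₁ → ⟦ e₁ ⟧ ρ c₁ * sumL W₂ (λ c₂ → ⟦ e₂ ⟧ ρ c₂ * ⟦ l ⟧ (match v₁ c₁ (match v₂ c₂ ρ)) b))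
      ≈⟨ sumL-*-sumL-comm W₁ W₂ _ _ _ ⟩
    sumL W₂ (λ c₂ → ⟦ e₂ ⟧ ρ c₂ * sumL W₁ (λ c₁ → ⟦ e₁ ⟧ ρ c₁ * ⟦ l ⟧ (match v₁ c₁ (match v₂ c₂ ρ)) b))
      ≈⟨ sumL-cong W₂ (λ _ → *-congˡ (sumL-cong W₁ (λ c₁∈ →
           *-congʳ (≈-sym (⟦⟧-agree ⊢e₁ (match-disjoint v₂ _ ρ v₂#e₁) c₁∈))))) ⟩
    ⟦ let′ v₂ e₂ (let′ v₁ e₁ l) ⟧ ρ b
      ∎
    where
      W₁ = web (patTy v₁)
      W₂ = web (patTy v₂)

  -- The outer sum ranges over the graph (a , d) of f; the call f x contributes δ (X c₁) a · δ d c₂,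
  -- which sifts out both a and d.
  S₂-sound : ∀ v₁ e₁ v₂ e₂ l x f {U} → e₁ ⦂ patTy v₁ → e₂ ⦂ patTy v₂ → l ⦂ U
           → ty f ≡ (patTy x ⊸ patTy v₂)
           → pvars x ⊆ pvars v₁ → (∀ {w} → w ∈ FV e₂ → w ∈ pvars v₁ → w ∈ pvars x)
           → f ∉ FV e₁ → f ∉ FV l → f ∉ pvars v₁
           → ∀ ρ → WfEnv ρ → ∀ b → b ∈ web U
           → ⟦ let′ v₁ e₁ (let′ v₂ e₂ l) ⟧ ρ b
           ≈ ⟦ let′ (pv f) (lam x e₂) (let′ v₁ e₁ (let′ v₂ (app f x) l)) ⟧ ρ b
  S₂-sound v₁ e₁ v₂ e₂ l x f ⊢e₁ ⊢e₂ ⊢l ty-f x⊆v₁ v₁∩e₂⊆x f∉e₁ f∉l f∉v₁ ρ ρ-wf b b∈ = ≈-sym (begin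
    ⟦ let′ (pv f) (lam x e₂) (let′ v₁ e₁ (let′ v₂ (app f x) l)) ⟧ ρ b
      ≡⟨ cong (λ T → sumL (web T) F) ty-f ⟩
    sumL (web (patTy x ⊸ patTy v₂)) F
      ≈⟨ sumL-cartesianProduct Wx W₂ F ⟩
    sumL Wx (λ a → sumL W₂ (λ d → E₂ a d * sumL W₁ (λ c₁ →
      ⟦ e₁ ⟧ (ρ [ f ↦ a ,, d ]) c₁ * ⟦ let′ v₂ (app f x) l ⟧ (match v₁ c₁ (ρ [ f ↦ a ,, d ])) b)))
      ≈⟨ sumL-cong Wx (λ {a} _ → sumL-cong W₂ (λ {d} d∈ → *-congˡ (sumL-cong W₁ (λ c₁∈ →
           *-cong (⟦⟧-agree ⊢e₁ ([↦]-∉ ρ (a ,, d) f∉e₁) c₁∈) (call-f a c₁∈ d∈))))) ⟩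
    sumL Wx (λ a → sumL W₂ (λ d → E₂ a d * sumL W₁ (λ c₁ → ⟦ e₁ ⟧ ρ c₁ * (δ (X c₁) a * L c₁ d))))
      ≈⟨ sumL-sumL-*-sumL-comm Wx W₂ W₁ E₂ (⟦ e₁ ⟧ ρ) (λ c₁ a → δ (X c₁) a) L ⟩
    sumL W₁ (λ c₁ → ⟦ e₁ ⟧ ρ c₁ * sumL Wx (λ a → δ (X c₁) a * sumL W₂ (λ d → E₂ a d * L c₁ d)))
      ≈⟨ sumL-cong W₁ (λ c₁∈ → *-congˡ (sumL-δ-web (patTy x) _ (lookP-wf x (match-wf v₁ ρ-wf c₁∈)))) ⟩
    sumL W₁ (λ c₁ → ⟦ e₁ ⟧ ρ c₁ * sumL W₂ (λ d → E₂ (X c₁) d * L c₁ d))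
      ≈⟨ sumL-cong W₁ (λ {c₁} _ → *-congˡ (sumL-cong W₂ (λ d∈ →
           *-congʳ (⟦⟧-agree ⊢e₂ (rematch-agree v₁ x c₁ ρ (FV e₂) v₁∩e₂⊆x) d∈)))) ⟩
    ⟦ let′ v₁ e₁ (let′ v₂ e₂ l) ⟧ ρ b
      ∎)
    where
      W₁ = web (patTy v₁)
      W₂ = web (patTy v₂)
      Wx = web (patTy x)
      X : W → W
      X c₁ = lookP x (match v₁ c₁ ρ)
      E₂ : W → W → Carrier
      E₂ a d = ⟦ e₂ ⟧ (match x a ρ) d
      L : W → W → Carrier
      L c₁ d = ⟦ l ⟧ (match v₂ d (match v₁ c₁ ρ)) b
      F : W → Carrier
      F cf = ⟦ lam x e₂ ⟧ ρ cf * sumL W₁ (λ c₁ →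
               ⟦ e₁ ⟧ (ρ [ f ↦ cf ]) c₁ * ⟦ let′ v₂ (app f x) l ⟧ (match v₁ c₁ (ρ [ f ↦ cf ])) b)

      call-f : ∀ a {c₁ d} → c₁ ∈ W₁ → d ∈ W₂
             → ⟦ let′ v₂ (app f x) l ⟧ (match v₁ c₁ (ρ [ f ↦ a ,, d ])) b ≈ δ (X c₁) a * L c₁ d
      call-f a {c₁} {d} c₁∈ d∈ = ≈-trans
        (⟦let-app⟧ v₂ f x l b (trans (match-∉ v₁ c₁ _ f∉v₁) ([↦]-same ρ f (a ,, d))) d∈)
        (*-cong (≈-reflexive (trans (cong (δ a) x-unchanged) (δ-sym a (X c₁))))
                (⟦⟧-agree ⊢l (λ w∈ → match-pointwise v₂ d (match-pointwise v₁ c₁ ([↦]-∉ ρ _ f∉l w∈))) b∈))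
        where
          x-unchanged : lookP x (match v₁ c₁ (ρ [ f ↦ a ,, d ])) ≡ X c₁
          x-unchanged = lookP-cong x (λ w∈ → match-∈ v₁ _ ρ c₁∈ (x⊆v₁ w∈))

  merge-sound : ∀ v e₁ p q e₂ l {U} → l ⦂ U
              → (∀ {w} → w ∈ FV l ∖ pvars q → w ∈ pvars v → w ∈ pvars p)
              → ∀ ρ → WfEnv ρ → ∀ b → b ∈ web U
              → ⟦ let′ v e₁ (let′ q e₂ l) ⟧ ρ b ≈ ⟦ let′ (pp p q) (let′ v e₁ (pair ⌜ p ⌝ e₂)) l ⟧ ρ b
  merge-sound v e₁ p q e₂ l ⊢l kept ρ ρ-wf b b∈ = ≈-sym (begin
    ⟦ let′ (pp p q) (let′ v e₁ (pair ⌜ p ⌝ e₂)) l ⟧ ρ b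
      ≈⟨ ⟦let-let⟧ (pp p q) v e₁ (pair ⌜ p ⌝ e₂) l ρ b ⟩
    sumL Wv (λ c → ⟦ e₁ ⟧ ρ c * sumL (web (patTy p ⊗ patTy q)) (λ cc →
      ⟦ pair ⌜ p ⌝ e₂ ⟧ (match v c ρ) cc * ⟦ l ⟧ (match (pp p q) cc ρ) b))
      ≈⟨ sumL-cong Wv (λ c∈ → *-congˡ (sumL-⟦pattern,⟧ p e₂ (patTy q) _ (match-wf v ρ-wf c∈))) ⟩
    sumL Wv (λ c → ⟦ e₁ ⟧ ρ c * sumL Wq (λ c₂ →
      ⟦ e₂ ⟧ (match v c ρ) c₂ * ⟦ l ⟧ (match q c₂ (match p (lookP p (match v c ρ)) ρ)) b))
      ≈⟨ sumL-cong Wv (λ {c} _ → *-congˡ (sumL-cong Wq (λ c₂∈ → *-congˡ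
           (⟦⟧-agree ⊢l (match-cong q (FV l) c₂∈ (rematch-agree v p c ρ _ kept)) b∈)))) ⟩
    ⟦ let′ v e₁ (let′ q e₂ l) ⟧ ρ b
      ∎)
    where
      Wv = web (patTy v)
      Wq = web (patTy q)

  float-sound : ∀ v e₁ q e₂ l {U} → l ⦂ U → Disjoint (pvars v) (FV l ∖ pvars q)
              → ∀ ρ b → b ∈ web U
              → ⟦ let′ v e₁ (let′ q e₂ l) ⟧ ρ b ≈ ⟦ let′ q (let′ v e₁ e₂) l ⟧ ρ b
  float-sound v e₁ q e₂ l ⊢l v#l ρ b b∈ = ≈-sym (begin
    ⟦ let′ q (let′ v e₁ e₂) l ⟧ ρ b
      ≈⟨ ⟦let-let⟧ q v e₁ e₂ l ρ b ⟩
    sumL Wv (λ c → ⟦ e₁ ⟧ ρ c * sumL Wq (λ c₂ → ⟦ e₂ ⟧ (match v c ρ) c₂ * ⟦ l ⟧ (match q c₂ ρ) b))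
      ≈⟨ sumL-cong Wv (λ {c} _ → *-congˡ (sumL-cong Wq (λ c₂∈ → *-congˡ
           (⟦⟧-agree ⊢l (match-cong q (FV l) c₂∈ (λ w∈ → sym (match-disjoint v c ρ v#l w∈))) b∈)))) ⟩
    ⟦ let′ v e₁ (let′ q e₂ l) ⟧ ρ b
      ∎)
    where
      Wv = web (patTy v)
      Wq = web (patTy q)

  S₃-sound : ∀ v₁ e₁ v₂ e₂ l f {U} → l ⦂ U → f ∉ FV l
           → ∀ ρ → WfEnv ρ → ∀ b → b ∈ web U
           → ⟦ let′ v₁ e₁ (let′ v₂ e₂ l) ⟧ ρ b
           ≈ ⟦ let′ (pairPat (removeVar f v₁) v₂) (let′ v₁ e₁ (pairE (removeVar f v₁) e₂)) l ⟧ ρ b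
  S₃-sound v₁ e₁ v₂ e₂ l f ⊢l f∉l ρ ρ-wf b b∈
    with removeVar f v₁ | removeVar-kept f v₁ {FV l ∖ pvars v₂} (λ f∈ → f∉l (proj₁ (∈-∖⁻ f∈)))
  ... | nothing | kept = float-sound v₁ e₁ v₂ e₂ l ⊢l (λ { (w∈v₁ , w∈l) → ¬Any[] (kept w∈l w∈v₁) }) ρ b b∈
  ... | just p  | kept = merge-sound v₁ e₁ p v₂ e₂ l ⊢l kept ρ ρ-wf b b∈

  Eₓ-sound : ∀ v e₁ v′ l {U} → l ⦂ U → (∀ {w} → w ∈ FV l → w ∈ pvars v → w ∈ pvars v′)
           → ∀ ρ → WfEnv ρ → ∀ b → b ∈ web U
           → ⟦ let′ v e₁ l ⟧ ρ b ≈ ⟦ let′ v′ (let′ v e₁ ⌜ v′ ⌝) l ⟧ ρ b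
  Eₓ-sound v e₁ v′ l ⊢l kept ρ ρ-wf b b∈ = ≈-sym (begin
    ⟦ let′ v′ (let′ v e₁ ⌜ v′ ⌝) l ⟧ ρ b
      ≈⟨ ⟦let-let⟧ v′ v e₁ ⌜ v′ ⌝ l ρ b ⟩
    sumL Wv (λ c → ⟦ e₁ ⟧ ρ c * sumL (web (patTy v′)) (λ c′ →
      ⟦ ⌜ v′ ⌝ ⟧ (match v c ρ) c′ * ⟦ l ⟧ (match v′ c′ ρ) b))
      ≈⟨ sumL-cong Wv (λ c∈ → *-congˡ (sumL-⟦pattern⟧ v′ _ (match-wf v ρ-wf c∈))) ⟩
    sumL Wv (λ c → ⟦ e₁ ⟧ ρ c * ⟦ l ⟧ (match v′ (lookP v′ (match v c ρ)) ρ) b)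
      ≈⟨ sumL-cong Wv (λ {c} _ → *-congˡ (⟦⟧-agree ⊢l (rematch-agree v v′ c ρ (FV l) kept) b∈)) ⟩
    ⟦ let′ v e₁ l ⟧ ρ b
      ∎)
    where Wv = web (patTy v)

  ⟶-sound : ∀ {l l′ T} → Barendregt l → l ⦂ T → l ⟶ l′
          → ∀ ρ → WfEnv ρ → ∀ b → b ∈ web T → ⟦ l ⟧ ρ b ≈ ⟦ l′ ⟧ ρ b
  ⟶-sound (unique , bound#free) (tlet _ ⊢v₁ ⊢e₁ (tlet _ ⊢v₂ ⊢e₂ ⊢l _ _) _ _)
          (S₁ {v₁} {e₁} {v₂} {e₂} {l} _ v₁#e₂) ρ _ b b∈ =
    S₁-sound v₁ e₁ v₂ e₂ l (retype ⊢v₁ ⊢e₁) (retype ⊢v₂ ⊢e₂) ⊢l v₁#e₂ v₂#e₁ v₁#v₂ ρ b b∈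
    where
      v₂#e₁ : Disjoint (pvars v₂) (FV e₁)
      v₂#e₁ (w∈v₂ , w∈e₁) =
        bound#free (∈-++⁺ʳ (pvars v₁) (∈-++⁺ʳ (BV e₁) (∈-++⁺ˡ w∈v₂)) , ∈-++⁺ˡ w∈e₁)
      v₁#v₂ : Disjoint (pvars v₁) (pvars v₂)
      v₁#v₂ (w∈v₁ , w∈v₂) = Unique-++⇒Disjoint (pvars v₁) unique (w∈v₁ , ∈-++⁺ʳ (BV e₁) (∈-++⁺ˡ w∈v₂))
  ⟶-sound _ (tlet _ ⊢v₁ ⊢e₁ (tlet _ ⊢v₂ ⊢e₂ ⊢l _ _) _ _)
          (S₂ {v₁} {e₁} {v₂} {e₂} {l} x f _ x≡v₁∩e₂ _ _ ty-f f-fresh) ρ ρ-wf b b∈ =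
    S₂-sound v₁ e₁ v₂ e₂ l x f (retype ⊢v₁ ⊢e₁) ⊢e₂′ ⊢l (trans ty-f (cong (patTy x ⊸_) (tyOf-⦂ ⊢e₂′)))
      (λ w∈x → proj₁ (proj₁ (x≡v₁∩e₂ _) w∈x)) (λ w∈e₂ w∈v₁ → proj₂ (x≡v₁∩e₂ _) (w∈v₁ , w∈e₂))
      (λ f∈e₁ → f-fresh (∈-++⁺ˡ (∈-++⁺ˡ f∈e₁))) f∉l f∉v₁ ρ ρ-wf b b∈
    where
      ⊢e₂′ = retype ⊢v₂ ⊢e₂
      LHS = let′ v₁ e₁ (let′ v₂ e₂ l)
      f∉v₁ : f ∉ pvars v₁
      f∉v₁ f∈v₁ = f-fresh (∈-++⁺ʳ (FV LHS) (∈-++⁺ˡ f∈v₁))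
      f∉l : f ∉ FV l
      f∉l f∈l with FV-let-body v₂ e₂ l f∈l
      ... | inj₁ f∈v₂ = f-fresh (∈-++⁺ʳ (FV LHS) (∈-++⁺ʳ (pvars v₁) (∈-++⁺ʳ (BV e₁) (∈-++⁺ˡ f∈v₂))))
      ... | inj₂ f∈let with FV-let-body v₁ e₁ (let′ v₂ e₂ l) f∈let
      ...   | inj₁ f∈v₁  = f∉v₁ f∈v₁
      ...   | inj₂ f∈LHS = f-fresh (∈-++⁺ˡ f∈LHS)
  -- f is an arrow variable free in e₂, so linearity (FVa e₂ # FVa l) keeps it out of l.
  ⟶-sound _ (tlet _ _ _ (tlet _ _ _ ⊢l e₂#l _) _ _)
          (S₃ {v₁} {e₁} {v₂} {e₂} {l} f _ _ f-arrow f∈e₂) ρ ρ-wf b b∈ =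
    S₃-sound v₁ e₁ v₂ e₂ l f ⊢l (λ f∈l → e₂#l (∈-FVa⁺ e₂ f∈e₂ f-arrow , ∈-FVa⁺ l f∈l f-arrow)) ρ ρ-wf b b∈
  ⟶-sound _ (tlet _ _ _ (tlet _ _ _ ⊢l _ _) _ _) (Mr {v₁} {e₁} {v₂} {e₂} {l} _ _) ρ ρ-wf b b∈ =
    merge-sound v₁ e₁ v₁ v₂ e₂ l ⊢l (λ _ w∈v₁ → w∈v₁) ρ ρ-wf b b∈
  ⟶-sound _ (tlet _ _ _ ⊢l _ _) (Eₓ {v} {e₁} {l} x v′ _ _ _ x∉l v∖x≡v′) ρ ρ-wf b b∈ =
    Eₓ-sound v e₁ v′ l ⊢l kept ρ ρ-wf b b∈
    where
      kept : ∀ {w} → w ∈ FV l → w ∈ pvars v → w ∈ pvars v′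
      kept w∈l w∈v = subst (λ r → _ ∈ pvarsᵐ r) v∖x≡v′ (removeVar-kept x v x∉l w∈l w∈v)
  ⟶-sound bound (tlet {v} {e} {l} _ _ _ ⊢l _ _) (tail step) ρ ρ-wf b b∈ =
    sumL-cong (web (patTy v)) λ {c} c∈ →
      *-congˡ (⟶-sound (Barendregt-let⁻ v e l bound) ⊢l step (match v c ρ) (match-wf v ρ-wf c∈) b b∈)

proposition6 : ∀ {c ℓ} (R : CommutativeSemiring c ℓ) → let open Lang R in
    ∀ (l l' : Expr) (T : Ty) → IsLT l → Barendregt l → l ⦂ T → l' ⦂ T → l ⟶ l'
    → ∀ (ρ : Env) → WfEnv ρ → ∀ (b : W) → b ∈ web T → ⟦ l ⟧ ρ b ≈ ⟦ l' ⟧ ρ b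
proposition6 R _ _ _ _ bound ⊢l _ step = Soundness.⟶-sound R bound ⊢l step
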